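{- Let $G$ be a co-biconvex graph without universal vertices, with partition $(C_1,C_2)$ as described in the context. Let $\{i,j\}=\{1,2\}$, let $S\subseteq C_j$, and let $t$ be a positive integer such that $|N_G[v]\cap S|\geq t$ for every $v\in C_i$ (i.e. $S$ is a $t$-tuple dominating set of $G_i=G[C_i]$). Then $|S|\geq t+1$.
   Context: For a graph $G$ with vertices $v_1,\dots,v_n$, $M^*(G)$ is the $0,1$-matrix with entry $(i,j)=1$ iff $i=j$ or $v_iv_j\in E(G)$. $G$ is co-biconvex if the rows of $M^*(G)$ can be permuted so the 0's in every column are consecutive. Fix an ordering of the vertices (rows and columns of $M^*(G)$ in this order) in which the 0's of each column are consecutive; $C_1$ is the set of vertices whose column has its 0's below the main diagonal and $C_2$ those whose column has its 0's above. When $G$ has no universal vertices, $(C_1,C_2)$ partitions $V(G)$ into two cliques. $N_G[v]$ is the closed neighborhood of $v$ in $G$. -}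

module Defs where

open import Data.Nat using (ℕ; _<_; _≤_)
open import Data.Bool using (Bool; true; false; _∨_)
open import Data.Fin using (Fin; _≟_)
open import Data.Fin.Subset using (Subset)
open import Data.Fin.Permutation using (Permutation′; _⟨$⟩ʳ_; _⟨$⟩ˡ_)
open import Data.Vec using (tabulate)
open import Relation.Nullary using (¬_)
open import Relation.Nullary.Decidable using (⌊_⌋)
open import Relation.Binary.PropositionalEquality using (_≡_; _≢_)

record SimpleGraph (n : ℕ) : Set where
  field
    Adj    : Fin n → Fin n → Bool
    sym    : ∀ u v → Adj u v ≡ Adj v u
    irrefl : ∀ v → Adj v v ≡ false
open SimpleGraph public

-- M*(G): entry (u,w) is 1 (true) iff u = w or uw ∈ E(G)
M* : ∀ {n} → SimpleGraph n → Fin n → Fin n → Bool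
M* G u w = ⌊ u ≟ w ⌋ ∨ Adj G u w

N[_] : ∀ {n} → SimpleGraph n → Fin n → Subset n
N[ G ] v = tabulate (λ u → M* G v u)

IsUniversal : ∀ {n} → SimpleGraph n → Fin n → Set
IsUniversal G v = ∀ w → w ≢ v → Adj G v w ≡ true

NoUniversal : ∀ {n} → SimpleGraph n → Set
NoUniversal G = ∀ v → ¬ IsUniversal G v

-- A vertex ordering: π ⟨$⟩ʳ p is the vertex at position p;
-- π ⟨$⟩ˡ u is the position of vertex u (rows and columns of M*(G) in this order).
-- Row at position p, column of vertex u: entry M* G (π ⟨$⟩ʳ p) u.
ZeroAt : ∀ {n} → SimpleGraph n → Permutation′ n → Fin n → Fin n → Set
ZeroAt G π p u = M* G (π ⟨$⟩ʳ p) u ≡ false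

ConsecutiveZeros : ∀ {n} → SimpleGraph n → Permutation′ n → Set
ConsecutiveZeros G π = ∀ u p q r → p Data.Fin.≤ q → q Data.Fin.≤ r →
  ZeroAt G π p u → ZeroAt G π r u → ZeroAt G π q u

InC₁ : ∀ {n} → SimpleGraph n → Permutation′ n → Fin n → Set
InC₁ G π u = ∀ p → ZeroAt G π p u → (π ⟨$⟩ˡ u) Data.Fin.< p

InC₂ : ∀ {n} → SimpleGraph n → Permutation′ n → Fin n → Set
InC₂ G π u = ∀ p → ZeroAt G π p u → p Data.Fin.< (π ⟨$⟩ˡ u)

data Side : Set where
  one two : Side

other : Side → Side
other one = two
other two = one

InC : ∀ {n} → SimpleGraph n → Permutation′ n → Side → Fin n → Set
InC G π one = InC₁ G π
InC G π two = InC₂ G π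

module Submission where

-- The vertex u₀ in the first position for i = 1 (the last for i = 2) has a 0 off the
-- diagonal of its column, necessarily on the side of Cᵢ, so u₀ ∈ Cᵢ and S ≠ ∅.
-- Take s ∈ S and a non-neighbour w of s. Since s ∈ Cⱼ, w comes before s in the
-- order of side i, so the 0 in column w at the row of s puts w into Cᵢ, and
-- t ≤ |N[w] ∩ S| < |S| because s ∉ N[w].

open import Defs hiding (sym)
open import Data.Nat using (ℕ; suc; _<_; _≤_; z≤n)
open import Data.Nat.Properties using (<⇒≤; ≤-trans; ≤-<-trans)
open import Data.Fin using (Fin; fromℕ; _≟_) renaming (zero to fzero; _<_ to _<ᶠ_)
open import Data.Fin.Properties using (<-cmp; ≤∧≢⇒<; ≤fromℕ; all?; ¬∀⟶∃¬)
open import Data.Fin.Subset using (Subset; _∈_; _∉_; _∩_; ∣_∣; Nonempty)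
open import Data.Fin.Subset.Properties
  using (p⊂q⇒∣p∣<∣q∣; p∩q⊆q; x∈p∩q⁻; ∣p∩q∣≤∣q∣; nonempty?; Empty-unique; ∣⊥∣≡0)
open import Data.Fin.Permutation using (Permutation′; _⟨$⟩ʳ_; _⟨$⟩ˡ_; inverseˡ; inverseʳ)
open import Data.Vec.Properties using ([]=⇒lookup; lookup∘tabulate)
open import Data.Bool using (true; false)
open import Data.Bool.Properties using (¬-not) renaming (_≟_ to _≟ᵇ_)
open import Data.Product using (∃; _,_; proj₁; proj₂)
open import Data.Sum using (_⊎_; inj₁; inj₂; swap)
open import Function using (id)
open import Relation.Nullary using (¬_; yes; no; contradiction)
open import Relation.Binary using (tri<; tri≈; tri>)
open import Relation.Binary.PropositionalEquality
  using (_≡_; _≢_; refl; sym; trans; cong; subst; ≢-sym)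

x∈q∧x∉p⇒∣p∩q∣<∣q∣ : ∀ {n} {p q : Subset n} {x} → x ∈ q → x ∉ p → ∣ p ∩ q ∣ < ∣ q ∣
x∈q∧x∉p⇒∣p∩q∣<∣q∣ {p = p} {q} x∈q x∉p =
  p⊂q⇒∣p∣<∣q∣ (p∩q⊆q p q , _ , x∈q , λ x∈p∩q → x∉p (proj₁ (x∈p∩q⁻ p q x∈p∩q)))

0<∣p∣⇒Nonempty : ∀ {n} {p : Subset n} → 0 < ∣ p ∣ → Nonempty p
0<∣p∣⇒Nonempty {n} {p} 0<∣p∣ with nonempty? p
... | yes ne = ne
... | no ¬ne = contradiction (subst (0 <_) ∣p∣≡0 0<∣p∣) λ ()
  where
  ∣p∣≡0 : ∣ p ∣ ≡ 0
  ∣p∣≡0 = trans (cong ∣_∣ (Empty-unique ¬ne)) (∣⊥∣≡0 n)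

-- u ∈ Cᵢ says that every 0 of column u lies after the diagonal in the order ≺[ i ].

infix 4 _≺[_]_
_≺[_]_ : ∀ {n} → Fin n → Side → Fin n → Set
p ≺[ one ] q = p <ᶠ q
p ≺[ two ] q = q <ᶠ p

≺-other : ∀ {n} i {p q : Fin n} → p ≺[ other i ] q → q ≺[ i ] p
≺-other one = id
≺-other two = id

≺-cmp : ∀ {n} i {p q : Fin n} → p ≢ q → p ≺[ i ] q ⊎ q ≺[ i ] p
≺-cmp one {p} {q} p≢q with <-cmp p q
... | tri< p<q _ _ = inj₁ p<q
... | tri≈ _ p≡q _ = contradiction p≡q p≢q
... | tri> _ _ q<p = inj₂ q<p
≺-cmp two p≢q = swap (≺-cmp one p≢q)

first : ∀ {m} → Side → Fin (suc m)
first one = fzero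
first {m} two = fromℕ m

first-≺ : ∀ {m} i {q : Fin (suc m)} → q ≢ first i → first i ≺[ i ] q
first-≺ one q≢0 = ≤∧≢⇒< z≤n (≢-sym q≢0)
first-≺ two {q} q≢last = ≤∧≢⇒< (≤fromℕ q) q≢last

module _ {n} (G : SimpleGraph n) where

  M*-refl : ∀ u → M* G u u ≡ true
  M*-refl u with u ≟ u
  ... | yes _ = refl
  ... | no u≢u = contradiction refl u≢u

  M*-sym : ∀ u w → M* G u w ≡ M* G w u
  M*-sym u w with u ≟ w | w ≟ u
  ... | yes _   | yes _   = refl
  ... | yes u≡w | no w≢u  = contradiction (sym u≡w) w≢u
  ... | no u≢w  | yes w≡u = contradiction (sym w≡u) u≢w
  ... | no _    | no _    = SimpleGraph.sym G u w

  ∃-non-neighbour : NoUniversal G → ∀ u → ∃ λ w → M* G u w ≡ false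
  ∃-non-neighbour noU u with all? (λ w → M* G u w ≟ᵇ true)
  ... | yes all-true = contradiction universal (noU u)
    where
    universal : IsUniversal G u
    universal w w≢u with u ≟ w | all-true w
    ... | yes u≡w | _ = contradiction (sym u≡w) w≢u
    ... | no _    | adj = adj
  ... | no ¬all-true with ¬∀⟶∃¬ n _ (λ w → M* G u w ≟ᵇ true) ¬all-true
  ...   | w , ¬true = w , ¬-not ¬true

  non-neighbour⇒∉N[] : ∀ {u w} → M* G u w ≡ false → w ∉ N[ G ] u
  non-neighbour⇒∉N[] {u} {w} uw≡false w∈N[u] with
    trans (sym uw≡false) (trans (sym (lookup∘tabulate (M* G u) w)) ([]=⇒lookup w∈N[u]))
  ... | ()

module _ {n} (G : SimpleGraph n) (π : Permutation′ n) where

  private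
    pos : Fin n → Fin n
    pos u = π ⟨$⟩ˡ u

  non-neighbour⇒ZeroAt : ∀ {u w} → M* G u w ≡ false → ZeroAt G π (pos u) w
  non-neighbour⇒ZeroAt {u} {w} uw≡false = subst (λ v → M* G v w ≡ false) (sym (inverseʳ π)) uw≡false

  ¬ZeroAt-diagonal : ∀ u → ¬ ZeroAt G π (pos u) u
  ¬ZeroAt-diagonal u z with trans (sym (M*-refl G u)) (subst (λ v → M* G v u ≡ false) (inverseʳ π) z)
  ... | ()

  InC⇒≺ : ∀ i {u p} → InC G π i u → ZeroAt G π p u → pos u ≺[ i ] p
  InC⇒≺ one u∈C₁ = u∈C₁ _
  InC⇒≺ two u∈C₂ = u∈C₂ _

  ≺⇒InC : ∀ i {u} → (∀ p → ZeroAt G π p u → pos u ≺[ i ] p) → InC G π i u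
  ≺⇒InC one = id
  ≺⇒InC two = id

  module _ (consecutive : ConsecutiveZeros G π) where

    ZeroAt-between : ∀ i {u p q r} → p ≺[ i ] q → q ≺[ i ] r →
                     ZeroAt G π p u → ZeroAt G π r u → ZeroAt G π q u
    ZeroAt-between one p<q q<r = consecutive _ _ _ _ (<⇒≤ p<q) (<⇒≤ q<r)
    ZeroAt-between two q<p r<q zp zr = consecutive _ _ _ _ (<⇒≤ r<q) (<⇒≤ q<p) zr zp

    -- One 0 after the diagonal forces all of them there: a 0 before it would,
    -- by consecutiveness, put a 0 on the diagonal.
    ZeroAt-≻⇒InC : ∀ i {u q} → ZeroAt G π q u → pos u ≺[ i ] q → InC G π i u
    ZeroAt-≻⇒InC i {u} zq u≺q = ≺⇒InC i after
      where
      after : ∀ p → ZeroAt G π p u → pos u ≺[ i ] p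
      after p zp with p ≟ pos u
      ... | yes refl = contradiction zp (¬ZeroAt-diagonal u)
      ... | no p≢u with ≺-cmp i p≢u
      ...   | inj₁ p≺u = contradiction (ZeroAt-between i p≺u u≺q zp zq) (¬ZeroAt-diagonal u)
      ...   | inj₂ u≺p = u≺p

    non-neighbour⇒InC : ∀ i {u v} → M* G v u ≡ false → pos u ≺[ i ] pos v → InC G π i u
    non-neighbour⇒InC i vu≡false = ZeroAt-≻⇒InC i (non-neighbour⇒ZeroAt vu≡false)

first-InC : ∀ {m} (G : SimpleGraph (suc m)) (π : Permutation′ (suc m)) →
            ConsecutiveZeros G π → NoUniversal G → ∀ i → InC G π i (π ⟨$⟩ʳ first i)
first-InC {m} G π consecutive noU i = non-neighbour⇒InC G π consecutive i w-u₀ u₀≺w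
  where
  u₀ w : Fin (suc m)
  u₀ = π ⟨$⟩ʳ first i
  w = proj₁ (∃-non-neighbour G noU u₀)
  w-u₀ : M* G w u₀ ≡ false
  w-u₀ = trans (M*-sym G w u₀) (proj₂ (∃-non-neighbour G noU u₀))
  pos-u₀ : π ⟨$⟩ˡ u₀ ≡ first i
  pos-u₀ = inverseˡ π
  u₀≺w : π ⟨$⟩ˡ u₀ ≺[ i ] π ⟨$⟩ˡ w
  u₀≺w = subst (λ p → p ≺[ i ] π ⟨$⟩ˡ w) (sym pos-u₀) (first-≺ i w≢first)
    where
    w≢first : π ⟨$⟩ˡ w ≢ first i
    w≢first w≡first = ¬ZeroAt-diagonal G π u₀
      (subst (λ p → ZeroAt G π p u₀) (trans w≡first (sym pos-u₀)) (non-neighbour⇒ZeroAt G π w-u₀))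

lemma4p4 : (n : ℕ) → 0 < n → (G : SimpleGraph n) → (π : Permutation′ n) →
    ConsecutiveZeros G π → NoUniversal G →
    (i : Side) → (S : Subset n) → (∀ s → s ∈ S → InC G π (other i) s) →
    (t : ℕ) → 1 ≤ t →
    (∀ v → InC G π i v → t ≤ ∣ N[ G ] v ∩ S ∣) →
    t < ∣ S ∣
lemma4p4 (suc m) _ G π consecutive noU i S S⊆Cⱼ t 1≤t dominates =
  ≤-<-trans (dominates w w∈Cᵢ) (x∈q∧x∉p⇒∣p∩q∣<∣q∣ s∈S (non-neighbour⇒∉N[] G w-s))
  where
  u₀ : Fin (suc m)
  u₀ = π ⟨$⟩ʳ first i
  S-nonempty : Nonempty S
  S-nonempty = 0<∣p∣⇒Nonempty
    (≤-trans 1≤t (≤-trans (dominates u₀ (first-InC G π consecutive noU i)) (∣p∩q∣≤∣q∣ (N[ G ] u₀) S)))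
  s w : Fin (suc m)
  s = proj₁ S-nonempty
  s∈S : s ∈ S
  s∈S = proj₂ S-nonempty
  w = proj₁ (∃-non-neighbour G noU s)
  s-w : M* G s w ≡ false
  s-w = proj₂ (∃-non-neighbour G noU s)
  w-s : M* G w s ≡ false
  w-s = trans (M*-sym G w s) s-w
  w≺s : π ⟨$⟩ˡ w ≺[ i ] π ⟨$⟩ˡ s
  w≺s = ≺-other i (InC⇒≺ G π (other i) (S⊆Cⱼ s s∈S) (non-neighbour⇒ZeroAt G π w-s))
  w∈Cᵢ : InC G π i w
  w∈Cᵢ = non-neighbour⇒InC G π consecutive i s-w w≺s
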